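{- Let $\mathcal{S}=\{p_i=0 : i\in I\}$ be a set of polynomial equations over $\mathbb{R}$. If $\mathcal{S}$ has a sum-of-squares ($\mathsf{SoS}$) refutation of degree $d$, then $\mathcal{S}$ has a $\mathsf{PC}^{+}$ refutation of degree $d$. Moreover, this $\mathsf{PC}^{+}$ refutation does not use the radical rule.
   Context: Polynomial calculus over a ring $\mathcal{R}$ ($\mathsf{PC}_\mathcal{R}$): a derivation of $q=0$ from a set of equations $\mathcal{F}$ is a sequence of equations ending in $q=0$, each of which is a member of $\mathcal{F}$, or $0=0$, or follows from earlier lines by the addition rule (from $p=0$ and $r=0$ derive $ap+br=0$, for $a,b\in\mathcal{R}$) or the multiplication rule (from $p=0$ derive $p x_i=0$ for a variable $x_i$). A refutation is a derivation of $1=0$. The radical rule is: from $p^2=0$ derive $p=0$. The sum-of-squares rule is: from $p^2+\sum_i q_i^2=0$ derive $p^2=0$. $\mathsf{PC}^{+}$ is $\mathsf{PC}_{\mathbb{R}}$ plus the radical rule and the sum-of-squares rule (no Boolean axioms are included). The degree of a derivation is the maximum degree of a polynomial appearing in it. An $\mathsf{SoS}$ derivation of $q\ge 0$ from $\{p_i=0:i\in I\}$ (over $\mathbb{R}$) is a family of polynomials $(r_i)_{i\in I}$ and a family $(s_j)_{j\in J}$ with $\sum_i r_ip_i+\sum_j s_j^2\equiv q$ as polynomials; a refutation is a derivation of $-1\ge 0$; its degree is the maximum degree of any term $r_ip_i$ or $s_j^2$. If the set of assumptions is infinite, a derivation from it means a derivation from some finite subset. -}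

module Defs where

open import Level using (Level; _⊔_) renaming (suc to lsuc)
open import Algebra.Bundles using (CommutativeRing)
open import Relation.Binary.Structures using (IsTotalOrder)
open import Data.Nat as ℕ using (ℕ; zero; suc)
open import Data.List using (List; []; _∷_; _++_; map; concatMap; foldr; replicate)
open import Data.List.Properties using (≡-dec)
open import Data.Product using (_×_; _,_; Σ; ∃)
open import Data.Bool using (Bool; true; false)
open import Relation.Nullary using (¬_; yes; no)
open import Relation.Binary.PropositionalEquality using (_≡_)
import Data.List.Membership.Propositional

-- The real numbers, axiomatised as a (Dedekind-)complete ordered field.
-- (All such fields are isomorphic to ℝ; the statement quantifies over
-- every model, so it is a statement about ℝ.)

record RealField (c ℓ : Level) : Set (lsuc (c ⊔ ℓ)) where
  field
    commutativeRing : CommutativeRing c ℓ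
  open CommutativeRing commutativeRing public
  field
    _≤_         : Carrier → Carrier → Set ℓ
    isTotalOrder : IsTotalOrder _≈_ _≤_
    +-mono-≤    : ∀ {x y} z → x ≤ y → (x + z) ≤ (y + z)
    *-nonneg    : ∀ {x y} → 0# ≤ x → 0# ≤ y → 0# ≤ (x * y)
    0≉1         : ¬ (0# ≈ 1#)
    inverse     : ∀ x → ¬ (x ≈ 0#) → Σ Carrier (λ y → (x * y) ≈ 1#)
    complete    : (P : Carrier → Set ℓ) → Σ Carrier P →
                  Σ Carrier (λ b → ∀ x → P x → x ≤ b) →
                  Σ Carrier (λ s → (∀ x → P x → x ≤ s) ×
                                   (∀ b → (∀ x → P x → x ≤ b) → s ≤ b))

module PolyOver {c ℓ : Level} (F : RealField c ℓ) where
  open RealField F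

  -- A monomial is an exponent vector: (e₀ ∷ e₁ ∷ …) means x₀^e₀ x₁^e₁ ⋯;
  -- trailing zeros are irrelevant.
  Mono : Set
  Mono = List ℕ

  _⊕_ : Mono → Mono → Mono
  [] ⊕ n = n
  (a ∷ m) ⊕ [] = a ∷ m
  (a ∷ m) ⊕ (b ∷ n) = (a ℕ.+ b) ∷ (m ⊕ n)

  normM : Mono → Mono
  normM [] = []
  normM (x ∷ m) with normM m
  ... | [] with x ℕ.≟ 0
  ...   | yes _ = []
  ...   | no _  = x ∷ []
  normM (x ∷ m) | r ∷ rs = x ∷ r ∷ rs

  degM : Mono → ℕ
  degM = foldr ℕ._+_ 0

  -- A polynomial is a finite formal sum of terms c·m; it denotes the
  -- polynomial whose coefficients are given by `coeff`.
  Poly : Set c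
  Poly = List (Carrier × Mono)

  coeff : Poly → Mono → Carrier
  coeff [] m = 0#
  coeff ((a , m′) ∷ p) m with ≡-dec ℕ._≟_ (normM m′) (normM m)
  ... | yes _ = a + coeff p m
  ... | no _  = coeff p m

  _≃_ : Poly → Poly → Set ℓ
  p ≃ q = ∀ m → coeff p m ≈ coeff q m

  DegLe : Poly → ℕ → Set ℓ
  DegLe p d = ∀ m → d ℕ.< degM m → coeff p m ≈ 0#

  const : Carrier → Poly
  const a = (a , []) ∷ []

  zeroP oneP : Poly
  zeroP = []
  oneP = const 1#

  var : ℕ → Poly
  var k = (1# , replicate k 0 ++ (1 ∷ [])) ∷ []

  _+P_ : Poly → Poly → Poly
  p +P q = p ++ q

  scale : Carrier → Poly → Poly
  scale a = map (λ { (b , m) → (a * b , m) })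

  _*P_ : Poly → Poly → Poly
  p *P q = concatMap (λ { (a , m) → map (λ { (b , n) → (a * b , m ⊕ n) }) q }) p

  sumP : List Poly → Poly
  sumP = foldr _+P_ zeroP

  sumSquares : List Poly → Poly
  sumSquares qs = sumP (map (λ q → q *P q) qs)

  -- A line "q = 0" is represented by q.
  -- The Bool index says whether the radical rule may be used.
  -- Derivations are trees (equivalent to sequences for existence and degree).

  module _ {ι : Level} {I : Set ι} (p : I → Poly) (d : ℕ) where

    data PC⁺ (rad : Bool) : Poly → Set (c ⊔ ℓ ⊔ ι) where
      axiom : ∀ {q} (i : I) → q ≃ p i → DegLe q d → PC⁺ rad q
      zero= : ∀ {q} → q ≃ zeroP → PC⁺ rad q
      add   : ∀ {q r s} → PC⁺ rad r → PC⁺ rad s → (a b : Carrier) →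
              q ≃ (scale a r +P scale b s) → DegLe q d → PC⁺ rad q
      mult  : ∀ {q r} → PC⁺ rad r → (k : ℕ) →
              q ≃ (r *P var k) → DegLe q d → PC⁺ rad q
      radical : ∀ {q s} → rad ≡ true → PC⁺ rad s → s ≃ (q *P q) →
              DegLe q d → PC⁺ rad q
      sos   : ∀ {q s} (r : Poly) (ts : List Poly) → PC⁺ rad s →
              s ≃ ((r *P r) +P sumSquares ts) →
              q ≃ (r *P r) → DegLe q d → PC⁺ rad q

    PC⁺Refutation : Bool → Set (c ⊔ ℓ ⊔ ι)
    PC⁺Refutation rad = PC⁺ rad oneP

    record SoSRefutation : Set (c ⊔ ℓ ⊔ ι) where
      field
        rs : List (I × Poly)
        ss : List Poly
        identity : (sumP (map (λ { (i , r) → r *P p i }) rs) +P sumSquares ss)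
                   ≃ const (- 1#)
        degR : ∀ {i r} → Data.List.Membership.Propositional._∈_ (i , r) rs → DegLe (r *P p i) d
        degS : ∀ {s} → Data.List.Membership.Propositional._∈_ s ss → DegLe (s *P s) d

{-# OPTIONS --safe #-}
module Submission where

-- Write the certificate as Σᵢ rᵢ pᵢ + Σⱼ sⱼ² = -1. Each product rᵢ pᵢ is derived by multiplying
-- the axiom pᵢ by the monomials x^ν of rᵢ one variable at a time and combining linearly. All these
-- lines have degree ≤ d: in the graded lexicographic order, the product of the leading monomials
-- of rᵢ and pᵢ has the nonzero coefficient lc(rᵢ) lc(pᵢ) in rᵢ pᵢ, so deg ν + deg pᵢ ≤ deg (rᵢ pᵢ) ≤ d.
-- Scaling the derived line Σᵢ rᵢ pᵢ = 0 by -1 gives 1² + Σⱼ sⱼ² = 0, and the sum-of-squares rule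
-- yields 1 = 0. Leading monomials can be found because equality
-- with 0# is decidable in every model of RealField: completeness applies to arbitrary predicates,
-- which gives ¬ A ⊎ ¬ ¬ A, and x ≈ 0# is stable under double negation.

open import Defs
open import Level using (Level)
open import Data.Nat using (ℕ)
open import Data.Bool using (false)
open import Data.Product using (_,_)

module OrderedField {c ℓ} (F : RealField c ℓ) where
  open import Relation.Binary.Structures using (IsTotalOrder)
  open RealField F
  open IsTotalOrder isTotalOrder using (total; antisym; ≤-respˡ-≈; ≤-respʳ-≈)
    renaming (refl to ≤-refl; trans to ≤-trans; reflexive to ≤-reflexive)
  open import Algebra.Properties.Ring ring using (-‿distribˡ-*; -‿involutive; -0#≈0#)
  open import Data.Empty using (⊥-elim)
  open import Data.Product using (_×_; proj₁; proj₂)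
  open import Data.Sum as Sum using (_⊎_; inj₁; inj₂)
  open import Relation.Binary.Reasoning.Setoid setoid
  open import Relation.Nullary using (¬_; Dec; yes; no)

  x+y-y≈x : ∀ x y → x + y - y ≈ x
  x+y-y≈x x y = trans (+-assoc x y (- y)) (trans (+-congˡ (-‿inverseʳ y)) (+-identityʳ x))

  x-y+y≈x : ∀ x y → x - y + y ≈ x
  x-y+y≈x x y = trans (+-assoc x (- y) y) (trans (+-congˡ (-‿inverseˡ y)) (+-identityʳ x))

  +-monoʳ-≤ : ∀ {x y} z → x ≤ y → (z + x) ≤ (z + y)
  +-monoʳ-≤ {x} {y} z x≤y = ≤-respˡ-≈ (+-comm x z) (≤-respʳ-≈ (+-comm y z) (+-mono-≤ z x≤y))

  +-cancelʳ-≤ : ∀ {x y} z → (x + z) ≤ (y + z) → x ≤ y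
  +-cancelʳ-≤ {x} {y} z x+z≤y+z =
    ≤-respˡ-≈ (x+y-y≈x x z) (≤-respʳ-≈ (x+y-y≈x y z) (+-mono-≤ (- z) x+z≤y+z))

  x≤0⇒0≤-x : ∀ {x} → x ≤ 0# → 0# ≤ (- x)
  x≤0⇒0≤-x {x} x≤0 = ≤-respˡ-≈ (-‿inverseʳ x) (≤-respʳ-≈ (+-identityˡ (- x)) (+-mono-≤ (- x) x≤0))

  -x≤0⇒0≤x : ∀ {x} → (- x) ≤ 0# → 0# ≤ x
  -x≤0⇒0≤x {x} -x≤0 = ≤-respˡ-≈ (-‿inverseˡ x) (≤-respʳ-≈ (+-identityˡ x) (+-mono-≤ x -x≤0))

  0≤1 : 0# ≤ 1#
  0≤1 with total 0# 1#
  ... | inj₁ 0≤1 = 0≤1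
  ... | inj₂ 1≤0 = ≤-respʳ-≈ -1*-1≈1 (*-nonneg (x≤0⇒0≤-x 1≤0) (x≤0⇒0≤-x 1≤0))
    where
    -1*-1≈1 : - 1# * - 1# ≈ 1#
    -1*-1≈1 = trans (sym (-‿distribˡ-* 1# (- 1#))) (trans (-‿cong (*-identityˡ (- 1#))) (-‿involutive 1#))

  1≰0 : ¬ (1# ≤ 0#)
  1≰0 1≤0 = 0≉1 (antisym 0≤1 1≤0)

  -- The set of nonnegative z with ¬ ¬ (z ≈ 0#) is bounded by 1# and closed under adding x,
  -- so its supremum s satisfies s + x ≤ s.
  nonneg-stable : ∀ {x} → 0# ≤ x → ¬ ¬ (x ≈ 0#) → x ≤ 0#
  nonneg-stable {x} 0≤x ¬¬x≈0 = +-cancelʳ-≤ s x+s≤0+s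
    where
    P : Carrier → Set ℓ
    P z = 0# ≤ z × ¬ ¬ (z ≈ 0#)
    P⇒≤1 : ∀ z → P z → z ≤ 1#
    P⇒≤1 z (_ , ¬¬z≈0) with total z 1#
    ... | inj₁ z≤1 = z≤1
    ... | inj₂ 1≤z = ⊥-elim (¬¬z≈0 λ z≈0 → 1≰0 (≤-respʳ-≈ z≈0 1≤z))
    P-+x : ∀ z → P z → P (z + x)
    P-+x z (0≤z , ¬¬z≈0) =
      ≤-trans 0≤z (≤-respˡ-≈ (+-identityʳ z) (+-monoʳ-≤ z 0≤x)) ,
      λ z+x≉0 → ¬¬z≈0 λ z≈0 → ¬¬x≈0 λ x≈0 → z+x≉0 (trans (+-cong z≈0 x≈0) (+-identityʳ 0#))
    sup = complete P (0# , ≤-refl , λ 0≉0 → 0≉0 refl) (1# , P⇒≤1)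
    s = proj₁ sup
    s-upper : ∀ z → P z → z ≤ s
    s-upper = proj₁ (proj₂ sup)
    s-least : ∀ b → (∀ z → P z → z ≤ b) → s ≤ b
    s-least = proj₂ (proj₂ sup)
    s≤s-x : s ≤ (s - x)
    s≤s-x = s-least (s - x) λ z Pz →
      +-cancelʳ-≤ x (≤-respʳ-≈ (sym (x-y+y≈x s x)) (s-upper (z + x) (P-+x z Pz)))
    x+s≤0+s : (x + s) ≤ (0# + s)
    x+s≤0+s = ≤-respˡ-≈ (+-comm s x) (≤-respʳ-≈ (trans (x-y+y≈x s x) (sym (+-identityˡ s))) (+-mono-≤ x s≤s-x))

  ≈0-stable : ∀ {x} → ¬ ¬ (x ≈ 0#) → x ≈ 0#
  ≈0-stable {x} ¬¬x≈0 with total x 0#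
  ... | inj₂ 0≤x = antisym (nonneg-stable 0≤x ¬¬x≈0) 0≤x
  ... | inj₁ x≤0 = antisym x≤0 (-x≤0⇒0≤x (nonneg-stable (x≤0⇒0≤-x x≤0) ¬¬-x≈0))
    where
    ¬¬-x≈0 : ¬ ¬ (- x ≈ 0#)
    ¬¬-x≈0 -x≉0 = ¬¬x≈0 λ x≈0 → -x≉0 (trans (-‿cong x≈0) -0#≈0#)

  -- s = sup ({1# | A} ∪ {- 1#}): s ≤ 0# refutes A, and 0# ≤ s refutes ¬ A.
  weak-excluded-middle : (A : Set ℓ) → ¬ A ⊎ ¬ ¬ A
  weak-excluded-middle A = Sum.map s≤0⇒¬A 0≤s⇒¬¬A (total s 0#)
    where
    P : Carrier → Set ℓ
    P z = (A × z ≈ 1#) ⊎ z ≈ - 1#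
    -1≤1 : (- 1#) ≤ 1#
    -1≤1 = ≤-trans (≤-respʳ-≈ (-‿inverseʳ 1#) (≤-respˡ-≈ (+-identityˡ (- 1#)) (+-mono-≤ (- 1#) 0≤1))) 0≤1
    P⇒≤1 : ∀ z → P z → z ≤ 1#
    P⇒≤1 z (inj₁ (_ , z≈1)) = ≤-reflexive z≈1
    P⇒≤1 z (inj₂ z≈-1)      = ≤-respˡ-≈ (sym z≈-1) -1≤1
    sup = complete P (- 1# , inj₂ refl) (1# , P⇒≤1)
    s = proj₁ sup
    s-upper : ∀ z → P z → z ≤ s
    s-upper = proj₁ (proj₂ sup)
    s-least : ∀ b → (∀ z → P z → z ≤ b) → s ≤ b
    s-least = proj₂ (proj₂ sup)
    P⇒≤-1 : ¬ A → ∀ z → P z → z ≤ (- 1#)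
    P⇒≤-1 ¬a z (inj₁ (a , _)) = ⊥-elim (¬a a)
    P⇒≤-1 ¬a z (inj₂ z≈-1)    = ≤-reflexive z≈-1
    s≤0⇒¬A : s ≤ 0# → ¬ A
    s≤0⇒¬A s≤0 a = 1≰0 (≤-trans (s-upper 1# (inj₁ (a , refl))) s≤0)
    0≤s⇒¬¬A : 0# ≤ s → ¬ ¬ A
    0≤s⇒¬¬A 0≤s ¬a = 1≰0 (≤-respˡ-≈ (+-identityˡ 1#) (≤-respʳ-≈ (-‿inverseˡ 1#)
      (+-mono-≤ 1# (≤-trans 0≤s (s-least (- 1#) (P⇒≤-1 ¬a))))))

  _≈0? : ∀ x → Dec (x ≈ 0#)
  x ≈0? with weak-excluded-middle (x ≈ 0#)
  ... | inj₁ x≉0   = no x≉0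
  ... | inj₂ ¬¬x≈0 = yes (≈0-stable ¬¬x≈0)

  *-nonzero : ∀ {x y} → x ≉ 0# → y ≉ 0# → x * y ≉ 0#
  *-nonzero {x} {y} x≉0 y≉0 xy≈0 = y≉0 (begin
    y             ≈⟨ *-identityˡ y ⟨
    1# * y        ≈⟨ *-congʳ (proj₂ (inverse x x≉0)) ⟨
    x * x⁻¹ * y   ≈⟨ *-congʳ (*-comm x x⁻¹) ⟩
    x⁻¹ * x * y   ≈⟨ *-assoc x⁻¹ x y ⟩
    x⁻¹ * (x * y) ≈⟨ *-congˡ xy≈0 ⟩
    x⁻¹ * 0#      ≈⟨ zeroʳ x⁻¹ ⟩
    0#            ∎)
    where x⁻¹ = proj₁ (inverse x x≉0)

-- Monomials do not depend on F; it is a parameter only because Defs defines them inside PolyOver.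
module Monomials {c ℓ} (F : RealField c ℓ) where
  open PolyOver F using (Mono; _⊕_; normM; degM)
  open import Data.Empty using (⊥-elim)
  open import Data.Nat
  open import Data.Nat.Properties
  open import Data.Product using (Σ; _×_; _,_)
  open import Data.Sum using (_⊎_; inj₁; inj₂)
  open import Data.List using (List; []; _∷_; _++_; map; replicate; length)
  open import Data.List.Properties using (≡-dec; length-++; length-map; length-replicate)
  open import Algebra.Properties.CommutativeSemigroup +-commutativeSemigroup using (interchange)
  open import Function using (_∘_; flip)
  open import Relation.Binary.PropositionalEquality
  open import Relation.Binary using (IsEquivalence; Setoid; DecSetoid; TotalOrder; Decidable; tri<; tri≈; tri>)
  import Relation.Nullary.Decidable as Dec
  open import Relation.Nullary using (¬_; yes; no)
  open import Level using (0ℓ)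
  open ≡-Reasoning

  -- A record rather than a synonym for normM μ ≡ normM ν, so that μ and ν can be
  -- inferred from a proof (normM is not injective).
  infix 4 _≈ₘ_
  record _≈ₘ_ (μ ν : Mono) : Set where
    constructor mk≈ₘ
    field normM≡ : normM μ ≡ normM ν
  open _≈ₘ_ using (normM≡)

  ≈ₘ-isEquivalence : IsEquivalence _≈ₘ_
  ≈ₘ-isEquivalence = record
    { refl  = mk≈ₘ refl
    ; sym   = λ (mk≈ₘ eq) → mk≈ₘ (sym eq)
    ; trans = λ (mk≈ₘ eq) (mk≈ₘ eq′) → mk≈ₘ (trans eq eq′)
    }

  open IsEquivalence ≈ₘ-isEquivalence public
    using () renaming (refl to ≈ₘ-refl; sym to ≈ₘ-sym; trans to ≈ₘ-trans)

  _≈ₘ?_ : Decidable _≈ₘ_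
  μ ≈ₘ? ν = Dec.map′ mk≈ₘ normM≡ (≡-dec _≟_ (normM μ) (normM ν))

  ≈ₘ-decSetoid : DecSetoid 0ℓ 0ℓ
  ≈ₘ-decSetoid = record
    { isDecEquivalence = record { isEquivalence = ≈ₘ-isEquivalence ; _≟_ = _≈ₘ?_ } }

  ≈ₘ-setoid : Setoid 0ℓ 0ℓ
  ≈ₘ-setoid = DecSetoid.setoid ≈ₘ-decSetoid

  exponent : Mono → ℕ → ℕ
  exponent []      _       = 0
  exponent (a ∷ μ) zero    = a
  exponent (a ∷ μ) (suc k) = exponent μ k

  consₙ : ℕ → Mono → Mono
  consₙ a [] with a ≟ 0
  ... | yes _ = []
  ... | no  _ = a ∷ []
  consₙ a (b ∷ μ) = a ∷ b ∷ μ

  normM-∷ : ∀ a μ → normM (a ∷ μ) ≡ consₙ a (normM μ)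
  normM-∷ a μ with normM μ
  ... | [] with a ≟ 0
  ...   | yes _ = refl
  ...   | no  _ = refl
  normM-∷ a μ | _ ∷ _ = refl

  exponent-consₙ : ∀ a μ → exponent (consₙ a μ) ≗ exponent (a ∷ μ)
  exponent-consₙ a [] k with a ≟ 0
  exponent-consₙ a [] zero    | yes a≡0 = sym a≡0
  exponent-consₙ a [] (suc k) | yes _   = refl
  ... | no _ = refl
  exponent-consₙ a (_ ∷ _) k = refl

  degM-consₙ : ∀ a μ → degM (consₙ a μ) ≡ a + degM μ
  degM-consₙ a [] with a ≟ 0
  ... | yes a≡0 = sym (trans (+-identityʳ a) a≡0)
  ... | no  _   = refl
  degM-consₙ a (_ ∷ _) = refl

  exponent-normM : ∀ μ → exponent (normM μ) ≗ exponent μ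
  exponent-normM []      k = refl
  exponent-normM (a ∷ μ) k =
    trans (cong (flip exponent k) (normM-∷ a μ)) (trans (exponent-consₙ a (normM μ) k) (tail k))
    where
    tail : ∀ k → exponent (a ∷ normM μ) k ≡ exponent (a ∷ μ) k
    tail zero    = refl
    tail (suc k) = exponent-normM μ k

  degM-normM : ∀ μ → degM (normM μ) ≡ degM μ
  degM-normM []      = refl
  degM-normM (a ∷ μ) =
    trans (cong degM (normM-∷ a μ)) (trans (degM-consₙ a (normM μ)) (cong (a +_) (degM-normM μ)))

  ≗⇒normM≡ : ∀ μ ν → exponent μ ≗ exponent ν → normM μ ≡ normM ν
  ≗⇒normM≡ []      []      _ = refl
  ≗⇒normM≡ []      (b ∷ ν) e = begin
    consₙ 0 (normM []) ≡⟨ cong₂ consₙ (e 0) (≗⇒normM≡ [] ν (e ∘ suc)) ⟩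
    consₙ b (normM ν)  ≡⟨ normM-∷ b ν ⟨
    normM (b ∷ ν)      ∎
  ≗⇒normM≡ (a ∷ μ) []      e = begin
    normM (a ∷ μ)      ≡⟨ normM-∷ a μ ⟩
    consₙ a (normM μ)  ≡⟨ cong₂ consₙ (e 0) (≗⇒normM≡ μ [] (e ∘ suc)) ⟩
    consₙ 0 (normM []) ∎
  ≗⇒normM≡ (a ∷ μ) (b ∷ ν) e = begin
    normM (a ∷ μ)     ≡⟨ normM-∷ a μ ⟩
    consₙ a (normM μ) ≡⟨ cong₂ consₙ (e 0) (≗⇒normM≡ μ ν (e ∘ suc)) ⟩
    consₙ b (normM ν) ≡⟨ normM-∷ b ν ⟨
    normM (b ∷ ν)     ∎

  ≗⇒≈ₘ : ∀ μ ν → exponent μ ≗ exponent ν → μ ≈ₘ ν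
  ≗⇒≈ₘ μ ν e = mk≈ₘ (≗⇒normM≡ μ ν e)

  ≈ₘ⇒≗ : ∀ {μ ν} → μ ≈ₘ ν → exponent μ ≗ exponent ν
  ≈ₘ⇒≗ {μ} {ν} (mk≈ₘ eq) k =
    trans (sym (exponent-normM μ k)) (trans (cong (flip exponent k) eq) (exponent-normM ν k))

  ≈ₘ⇒degM≡ : ∀ {μ ν} → μ ≈ₘ ν → degM μ ≡ degM ν
  ≈ₘ⇒degM≡ {μ} {ν} (mk≈ₘ eq) = trans (sym (degM-normM μ)) (trans (cong degM eq) (degM-normM ν))

  exponent-⊕ : ∀ μ ν k → exponent (μ ⊕ ν) k ≡ exponent μ k + exponent ν k
  exponent-⊕ []      ν       k       = refl
  exponent-⊕ (a ∷ μ) []      k       = sym (+-identityʳ _)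
  exponent-⊕ (a ∷ μ) (b ∷ ν) zero    = refl
  exponent-⊕ (a ∷ μ) (b ∷ ν) (suc k) = exponent-⊕ μ ν k

  degM-⊕ : ∀ μ ν → degM (μ ⊕ ν) ≡ degM μ + degM ν
  degM-⊕ []      ν       = refl
  degM-⊕ (a ∷ μ) []      = sym (+-identityʳ _)
  degM-⊕ (a ∷ μ) (b ∷ ν) = trans (cong ((a + b) +_) (degM-⊕ μ ν)) (interchange a b (degM μ) (degM ν))

  ⊕-assoc : ∀ μ ν ρ → (μ ⊕ ν) ⊕ ρ ≡ μ ⊕ (ν ⊕ ρ)
  ⊕-assoc []      ν       ρ       = refl
  ⊕-assoc (a ∷ μ) []      ρ       = refl
  ⊕-assoc (a ∷ μ) (b ∷ ν) []      = refl
  ⊕-assoc (a ∷ μ) (b ∷ ν) (x ∷ ρ) = cong₂ _∷_ (+-assoc a b x) (⊕-assoc μ ν ρ)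

  ⊕-comm : ∀ μ ν → μ ⊕ ν ≡ ν ⊕ μ
  ⊕-comm []      []      = refl
  ⊕-comm []      (b ∷ ν) = refl
  ⊕-comm (a ∷ μ) []      = refl
  ⊕-comm (a ∷ μ) (b ∷ ν) = cong₂ _∷_ (+-comm a b) (⊕-comm μ ν)

  ⊕-identityʳ : ∀ μ → μ ⊕ [] ≡ μ
  ⊕-identityʳ []      = refl
  ⊕-identityʳ (a ∷ μ) = refl

  ⊕-congʳ : ∀ {μ μ′} ν → μ ≈ₘ μ′ → μ ⊕ ν ≈ₘ μ′ ⊕ ν
  ⊕-congʳ {μ} {μ′} ν μ≈μ′ = ≗⇒≈ₘ (μ ⊕ ν) (μ′ ⊕ ν) λ k →
    trans (exponent-⊕ μ ν k) (trans (cong (_+ exponent ν k) (≈ₘ⇒≗ μ≈μ′ k)) (sym (exponent-⊕ μ′ ν k)))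

  ⊕-congˡ : ∀ μ {ν ν′} → ν ≈ₘ ν′ → μ ⊕ ν ≈ₘ μ ⊕ ν′
  ⊕-congˡ μ {ν} {ν′} ν≈ν′ rewrite ⊕-comm μ ν | ⊕-comm μ ν′ = ⊕-congʳ μ ν≈ν′

  ⊕-cancelˡ : ∀ μ {ν ν′} → μ ⊕ ν ≈ₘ μ ⊕ ν′ → ν ≈ₘ ν′
  ⊕-cancelˡ μ {ν} {ν′} eq = ≗⇒≈ₘ ν ν′ λ k → +-cancelˡ-≡ (exponent μ k) _ _
    (trans (sym (exponent-⊕ μ ν k)) (trans (≈ₘ⇒≗ eq k) (exponent-⊕ μ ν′ k)))

  varMono : ℕ → Mono
  varMono k = replicate k 0 ++ (1 ∷ [])

  ∏ : List ℕ → Mono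
  ∏ []       = []
  ∏ (k ∷ ks) = varMono k ⊕ ∏ ks

  indices : Mono → List ℕ
  indices []      = []
  indices (a ∷ μ) = replicate a 0 ++ map suc (indices μ)

  degM-varMono : ∀ k → degM (varMono k) ≡ 1
  degM-varMono zero    = refl
  degM-varMono (suc k) = degM-varMono k

  degM-∏ : ∀ ks → degM (∏ ks) ≡ length ks
  degM-∏ []       = refl
  degM-∏ (k ∷ ks) = trans (degM-⊕ (varMono k) (∏ ks)) (cong₂ _+_ (degM-varMono k) (degM-∏ ks))

  length-indices : ∀ μ → length (indices μ) ≡ degM μ
  length-indices []      = refl
  length-indices (a ∷ μ) = begin
    length (replicate a 0 ++ map suc (indices μ))         ≡⟨ length-++ (replicate a 0) ⟩
    length (replicate a 0) + length (map suc (indices μ)) ≡⟨ cong₂ _+_ (length-replicate a) (length-map suc (indices μ)) ⟩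
    a + length (indices μ)                                ≡⟨ cong (a +_) (length-indices μ) ⟩
    a + degM μ                                            ∎

  ∏-++ : ∀ ks ls → ∏ (ks ++ ls) ≡ ∏ ks ⊕ ∏ ls
  ∏-++ []       ls = refl
  ∏-++ (k ∷ ks) ls = trans (cong (varMono k ⊕_) (∏-++ ks ls)) (sym (⊕-assoc (varMono k) (∏ ks) (∏ ls)))

  exponent-∏-replicate : ∀ a → exponent (∏ (replicate a 0)) ≗ exponent (a ∷ [])
  exponent-∏-replicate zero    zero    = refl
  exponent-∏-replicate zero    (suc k) = refl
  exponent-∏-replicate (suc a) k       = begin
    exponent (varMono 0 ⊕ ∏ (replicate a 0)) k              ≡⟨ exponent-⊕ (varMono 0) (∏ (replicate a 0)) k ⟩
    exponent (varMono 0) k + exponent (∏ (replicate a 0)) k ≡⟨ cong (exponent (varMono 0) k +_) (exponent-∏-replicate a k) ⟩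
    exponent (varMono 0) k + exponent (a ∷ []) k            ≡⟨ exponent-⊕ (varMono 0) (a ∷ []) k ⟨
    exponent (suc a ∷ []) k                                 ∎

  exponent-∏-map-suc : ∀ ks → exponent (∏ (map suc ks)) ≗ exponent (0 ∷ ∏ ks)
  exponent-∏-map-suc []       zero    = refl
  exponent-∏-map-suc []       (suc j) = refl
  exponent-∏-map-suc (k ∷ ks) j       = begin
    exponent (varMono (suc k) ⊕ ∏ (map suc ks)) j              ≡⟨ exponent-⊕ (varMono (suc k)) (∏ (map suc ks)) j ⟩
    exponent (varMono (suc k)) j + exponent (∏ (map suc ks)) j ≡⟨ cong (exponent (varMono (suc k)) j +_) (exponent-∏-map-suc ks j) ⟩
    exponent (0 ∷ varMono k) j + exponent (0 ∷ ∏ ks) j         ≡⟨ exponent-⊕ (0 ∷ varMono k) (0 ∷ ∏ ks) j ⟨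
    exponent (0 ∷ ∏ (k ∷ ks)) j                                ∎

  exponent-∏-indices : ∀ μ → exponent (∏ (indices μ)) ≗ exponent μ
  exponent-∏-indices []      j = refl
  exponent-∏-indices (a ∷ μ) j = begin
    exponent (∏ (replicate a 0 ++ map suc (indices μ))) j
      ≡⟨ cong (flip exponent j) (∏-++ (replicate a 0) _) ⟩
    exponent (∏ (replicate a 0) ⊕ ∏ (map suc (indices μ))) j
      ≡⟨ exponent-⊕ (∏ (replicate a 0)) (∏ (map suc (indices μ))) j ⟩
    exponent (∏ (replicate a 0)) j + exponent (∏ (map suc (indices μ))) j
      ≡⟨ cong₂ _+_ (exponent-∏-replicate a j) (exponent-∏-map-suc (indices μ) j) ⟩
    exponent (a ∷ []) j + exponent (0 ∷ ∏ (indices μ)) j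
      ≡⟨ split j ⟩
    exponent (a ∷ μ) j
      ∎
    where
    split : ∀ j → exponent (a ∷ []) j + exponent (0 ∷ ∏ (indices μ)) j ≡ exponent (a ∷ μ) j
    split zero    = +-identityʳ a
    split (suc j) = exponent-∏-indices μ j

  ∏-indices : ∀ μ → ∏ (indices μ) ≈ₘ μ
  ∏-indices μ = ≗⇒≈ₘ (∏ (indices μ)) μ (exponent-∏-indices μ)

  infix 4 _<ₗₑₓ_
  _<ₗₑₓ_ : (ℕ → ℕ) → (ℕ → ℕ) → Set
  f <ₗₑₓ g = Σ ℕ λ k → f k < g k × (∀ j → j < k → f j ≡ g j)

  <ₗₑₓ-irrefl : ∀ {f g} → f <ₗₑₓ g → ¬ f ≗ g
  <ₗₑₓ-irrefl (k , fk<gk , _) f≗g = <-irrefl (f≗g k) fk<gk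

  <ₗₑₓ-resp-≗ : ∀ {f f′ g g′} → f ≗ f′ → g ≗ g′ → f <ₗₑₓ g → f′ <ₗₑₓ g′
  <ₗₑₓ-resp-≗ f≗f′ g≗g′ (k , fk<gk , agree) =
    k , subst₂ _<_ (f≗f′ k) (g≗g′ k) fk<gk , λ j j<k → trans (sym (f≗f′ j)) (trans (agree j j<k) (g≗g′ j))

  <ₗₑₓ-trans : ∀ {f g h} → f <ₗₑₓ g → g <ₗₑₓ h → f <ₗₑₓ h
  <ₗₑₓ-trans (k , fk<gk , agree) (k′ , gk′<hk′ , agree′) with <-cmp k k′
  ... | tri< k<k′ _ _ = k , <-≤-trans fk<gk (≤-reflexive (agree′ k k<k′)) ,
                        λ j j<k → trans (agree j j<k) (agree′ j (<-trans j<k k<k′))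
  ... | tri≈ _ refl _ = k , <-trans fk<gk gk′<hk′ , λ j j<k → trans (agree j j<k) (agree′ j j<k)
  ... | tri> _ _ k′<k = k′ , ≤-<-trans (≤-reflexive (agree k′ k′<k)) gk′<hk′ ,
                        λ j j<k′ → trans (agree j (<-trans j<k′ k′<k)) (agree′ j j<k′)

  <ₗₑₓ-+ʳ : ∀ {f g} (h : ℕ → ℕ) → f <ₗₑₓ g → (λ i → f i + h i) <ₗₑₓ (λ i → g i + h i)
  <ₗₑₓ-+ʳ h (k , fk<gk , agree) = k , +-monoˡ-< (h k) fk<gk , λ j j<k → cong (_+ h j) (agree j j<k)

  <ₗₑₓ-+ˡ : ∀ (f : ℕ → ℕ) {g h} → g <ₗₑₓ h → (λ i → f i + g i) <ₗₑₓ (λ i → f i + h i)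
  <ₗₑₓ-+ˡ f (k , gk<hk , agree) = k , +-monoʳ-< (f k) gk<hk , λ j j<k → cong (f j +_) (agree j j<k)

  LexOrdering : (ℕ → ℕ) → (ℕ → ℕ) → Set
  LexOrdering f g = f <ₗₑₓ g ⊎ f ≗ g ⊎ g <ₗₑₓ f

  lexOrdering-suc : ∀ {f g} → LexOrdering (f ∘ suc) (g ∘ suc) → LexOrdering f g
  lexOrdering-suc {f} {g} ord with <-cmp (f 0) (g 0)
  ... | tri< f0<g0 _ _ = inj₁ (0 , f0<g0 , λ _ ())
  ... | tri> _ _ g0<f0 = inj₂ (inj₂ (0 , g0<f0 , λ _ ()))
  ... | tri≈ _ f0≡g0 _ with ord
  ...   | inj₁ (k , lt , agree)        = inj₁ (suc k , lt , λ { zero _ → f0≡g0 ; (suc j) (s≤s j<k) → agree j j<k })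
  ...   | inj₂ (inj₁ f≗g)              = inj₂ (inj₁ λ { zero → f0≡g0 ; (suc k) → f≗g k })
  ...   | inj₂ (inj₂ (k , lt , agree)) = inj₂ (inj₂ (suc k , lt , λ { zero _ → sym f0≡g0 ; (suc j) (s≤s j<k) → agree j j<k }))

  exponent-lexOrdering : ∀ μ ν → LexOrdering (exponent μ) (exponent ν)
  exponent-lexOrdering []      []      = inj₂ (inj₁ λ _ → refl)
  exponent-lexOrdering []      (b ∷ ν) = lexOrdering-suc {exponent []} {exponent (b ∷ ν)} (exponent-lexOrdering [] ν)
  exponent-lexOrdering (a ∷ μ) []      = lexOrdering-suc {exponent (a ∷ μ)} {exponent []} (exponent-lexOrdering μ [])
  exponent-lexOrdering (a ∷ μ) (b ∷ ν) = lexOrdering-suc {exponent (a ∷ μ)} {exponent (b ∷ ν)} (exponent-lexOrdering μ ν)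

  -- Comparing keys lexicographically is the graded lexicographic monomial order.
  key : Mono → ℕ → ℕ
  key μ zero    = degM μ
  key μ (suc k) = exponent μ k

  key-lexOrdering : ∀ μ ν → LexOrdering (key μ) (key ν)
  key-lexOrdering μ ν = lexOrdering-suc {key μ} {key ν} (exponent-lexOrdering μ ν)

  key-⊕ : ∀ μ ν → key (μ ⊕ ν) ≗ λ i → key μ i + key ν i
  key-⊕ μ ν zero    = degM-⊕ μ ν
  key-⊕ μ ν (suc k) = exponent-⊕ μ ν k

  ≈ₘ⇒key≗ : ∀ {μ ν} → μ ≈ₘ ν → key μ ≗ key ν
  ≈ₘ⇒key≗ μ≈ν zero    = ≈ₘ⇒degM≡ μ≈ν
  ≈ₘ⇒key≗ μ≈ν (suc k) = ≈ₘ⇒≗ μ≈ν k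

  infix 4 _≤ₘ_
  _≤ₘ_ : Mono → Mono → Set
  μ ≤ₘ ν = key μ <ₗₑₓ key ν ⊎ μ ≈ₘ ν

  ≤ₘ-trans : ∀ {μ ν ρ} → μ ≤ₘ ν → ν ≤ₘ ρ → μ ≤ₘ ρ
  ≤ₘ-trans (inj₁ μ<ν) (inj₁ ν<ρ) = inj₁ (<ₗₑₓ-trans μ<ν ν<ρ)
  ≤ₘ-trans (inj₁ μ<ν) (inj₂ ν≈ρ) = inj₁ (<ₗₑₓ-resp-≗ (λ _ → refl) (≈ₘ⇒key≗ ν≈ρ) μ<ν)
  ≤ₘ-trans (inj₂ μ≈ν) (inj₁ ν<ρ) = inj₁ (<ₗₑₓ-resp-≗ (sym ∘ ≈ₘ⇒key≗ μ≈ν) (λ _ → refl) ν<ρ)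
  ≤ₘ-trans (inj₂ μ≈ν) (inj₂ ν≈ρ) = inj₂ (≈ₘ-trans μ≈ν ν≈ρ)

  ≤ₘ-antisym : ∀ {μ ν} → μ ≤ₘ ν → ν ≤ₘ μ → μ ≈ₘ ν
  ≤ₘ-antisym (inj₂ μ≈ν) _          = μ≈ν
  ≤ₘ-antisym (inj₁ μ<ν) (inj₂ ν≈μ) = ⊥-elim (<ₗₑₓ-irrefl μ<ν (sym ∘ ≈ₘ⇒key≗ ν≈μ))
  ≤ₘ-antisym (inj₁ μ<ν) (inj₁ ν<μ) = ⊥-elim (<ₗₑₓ-irrefl (<ₗₑₓ-trans μ<ν ν<μ) (λ _ → refl))

  ≤ₘ-total : ∀ μ ν → μ ≤ₘ ν ⊎ ν ≤ₘ μ
  ≤ₘ-total μ ν with key-lexOrdering μ ν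
  ... | inj₁ μ<ν        = inj₁ (inj₁ μ<ν)
  ... | inj₂ (inj₁ μ≗ν) = inj₁ (inj₂ (≗⇒≈ₘ μ ν (μ≗ν ∘ suc)))
  ... | inj₂ (inj₂ ν<μ) = inj₂ (inj₁ ν<μ)

  ≤ₘ-totalOrder : TotalOrder 0ℓ 0ℓ 0ℓ
  ≤ₘ-totalOrder = record
    { Carrier      = Mono
    ; _≈_          = _≈ₘ_
    ; _≤_          = _≤ₘ_
    ; isTotalOrder = record
      { isPartialOrder = record
        { isPreorder = record
          { isEquivalence = ≈ₘ-isEquivalence
          ; reflexive     = inj₂
          ; trans         = ≤ₘ-trans
          }
        ; antisym = ≤ₘ-antisym
        }
      ; total = ≤ₘ-total
      }
    }

  ≤ₘ⇒degM≤ : ∀ {μ ν} → μ ≤ₘ ν → degM μ ≤ degM ν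
  ≤ₘ⇒degM≤ (inj₁ (zero  , deg< , _))     = <⇒≤ deg<
  ≤ₘ⇒degM≤ (inj₁ (suc k , _    , agree)) = ≤-reflexive (agree 0 z<s)
  ≤ₘ⇒degM≤ (inj₂ μ≈ν)                    = ≤-reflexive (≈ₘ⇒degM≡ μ≈ν)

  -- A strict μ < α would give μ ⊕ ν < α ⊕ β, as the order is compatible with ⊕.
  ≤ₘ-⊕-tight : ∀ {μ ν α β} → μ ≤ₘ α → ν ≤ₘ β → μ ⊕ ν ≈ₘ α ⊕ β → μ ≈ₘ α
  ≤ₘ-⊕-tight (inj₂ μ≈α) _ _ = μ≈α
  ≤ₘ-⊕-tight {μ} {ν} {α} {β} (inj₁ μ<α) ν≤β eq = ⊥-elim (<ₗₑₓ-irrefl (μν<αβ ν≤β) (≈ₘ⇒key≗ eq))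
    where
    μν<αν : key (μ ⊕ ν) <ₗₑₓ (λ i → key α i + key ν i)
    μν<αν = <ₗₑₓ-resp-≗ (sym ∘ key-⊕ μ ν) (λ _ → refl) (<ₗₑₓ-+ʳ (key ν) μ<α)
    μν<αβ : ν ≤ₘ β → key (μ ⊕ ν) <ₗₑₓ key (α ⊕ β)
    μν<αβ (inj₁ ν<β) = <ₗₑₓ-resp-≗ (λ _ → refl) (sym ∘ key-⊕ α β) (<ₗₑₓ-trans μν<αν (<ₗₑₓ-+ˡ (key α) ν<β))
    μν<αβ (inj₂ ν≈β) = <ₗₑₓ-resp-≗ (λ _ → refl) (λ i → trans (cong (key α i +_) (≈ₘ⇒key≗ ν≈β i)) (sym (key-⊕ α β i))) μν<αν

module Polynomials {c ℓ} (F : RealField c ℓ) where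
  open RealField F
  open PolyOver F
  open OrderedField F
  open Monomials F
  open import Level using (Level)
  import Data.Nat as ℕ
  import Data.Nat.Properties as ℕₚ
  open import Data.List using (List; []; _∷_; _++_; map; filter; deduplicate)
  open import Data.List.Properties using (≡-dec)
  open import Data.List.Relation.Unary.All as All using (All; []; _∷_)
  open import Data.List.Relation.Unary.Any using (Any; here; there; any?)
  open import Data.List.Relation.Unary.AllPairs using ([]; _∷_)
  open import Data.List.Relation.Unary.Unique.Setoid ≈ₘ-setoid using (Unique)
  open import Data.List.Relation.Unary.Unique.DecSetoid.Properties using (deduplicate-!)
  open import Data.List.Membership.Propositional using (_∈_; lose; find)
  open import Data.List.Membership.Propositional.Properties using (∈-map⁺; ∈-filter⁺; ∈-filter⁻)
  import Data.List.Relation.Unary.Any.Properties as Anyₚ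
  open import Data.Product using (Σ; _×_; _,_; proj₁; proj₂)
  open import Data.Empty using (⊥-elim)
  open import Data.Sum using (inj₁; inj₂)
  open import Function using (_∘_; id)
  open import Function.Definitions using (Congruent)
  import Relation.Unary as U
  open import Relation.Nullary using (¬_; yes; no; ¬?)
  import Relation.Binary.PropositionalEquality as ≡
  open import Relation.Binary.Reasoning.Setoid setoid

  private
    variable
      a : Level
      A B : Set a

  ∑ : List A → (A → Carrier) → Carrier
  ∑ []       f = 0#
  ∑ (x ∷ xs) f = f x + ∑ xs f

  ∑-cong : ∀ {xs : List A} {f g} → All (λ x → f x ≈ g x) xs → ∑ xs f ≈ ∑ xs g
  ∑-cong []         = refl
  ∑-cong (fx≈gx ∷ eqs) = +-cong fx≈gx (∑-cong eqs)

  ∑-zero : ∀ {xs : List A} {f} → All (λ x → f x ≈ 0#) xs → ∑ xs f ≈ 0#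
  ∑-zero []              = refl
  ∑-zero (fx≈0 ∷ zeros) = trans (+-cong fx≈0 (∑-zero zeros)) (+-identityʳ 0#)

  ∑-++ : ∀ (xs ys : List A) f → ∑ (xs ++ ys) f ≈ ∑ xs f + ∑ ys f
  ∑-++ []       ys f = sym (+-identityˡ _)
  ∑-++ (x ∷ xs) ys f = trans (+-congˡ (∑-++ xs ys f)) (sym (+-assoc _ _ _))

  ∑-map : ∀ (h : A → B) xs f → ∑ (map h xs) f ≡.≡ ∑ xs (λ x → f (h x))
  ∑-map h []       f = ≡.refl
  ∑-map h (x ∷ xs) f = ≡.cong (f (h x) +_) (∑-map h xs f)

  ∑-+ : ∀ (xs : List A) f g → ∑ xs (λ x → f x + g x) ≈ ∑ xs f + ∑ xs g
  ∑-+ []       f g = sym (+-identityˡ 0#)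
  ∑-+ (x ∷ xs) f g = trans (+-congˡ (∑-+ xs f g)) (interchange (f x) (g x) (∑ xs f) (∑ xs g))
    where open import Algebra.Properties.CommutativeSemigroup +-commutativeSemigroup using (interchange)

  ∑-*ˡ : ∀ (xs : List A) a f → ∑ xs (λ x → a * f x) ≈ a * ∑ xs f
  ∑-*ˡ []       a f = sym (zeroʳ a)
  ∑-*ˡ (x ∷ xs) a f = trans (+-congˡ (∑-*ˡ xs a f)) (sym (distribˡ a _ _))

  ∑-*ʳ : ∀ (xs : List A) a f → ∑ xs (λ x → f x * a) ≈ ∑ xs f * a
  ∑-*ʳ xs a f = begin
    ∑ xs (λ x → f x * a) ≈⟨ ∑-cong {xs = xs} (All.tabulate λ {x} _ → *-comm (f x) a) ⟩
    ∑ xs (λ x → a * f x) ≈⟨ ∑-*ˡ xs a f ⟩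
    a * ∑ xs f           ≈⟨ *-comm a _ ⟩
    ∑ xs f * a           ∎

  -- Coefficients are pairings, coeff r ν ≈ ⟪ r ∣ (λ μ → δ μ ν) ⟫, so identities between
  -- formal sums are proved as identities between pairings.
  ⟪_∣_⟫ : Poly → (Mono → Carrier) → Carrier
  ⟪ p ∣ g ⟫ = ∑ p λ (a , μ) → a * g μ

  infixl 21 _·ₘ_
  _·ₘ_ : Poly → Mono → Poly
  p ·ₘ ν = map (λ (a , μ) → a , μ ⊕ ν) p

  ⟪⟫-cong : ∀ p {g g′} → (∀ μ → g μ ≈ g′ μ) → ⟪ p ∣ g ⟫ ≈ ⟪ p ∣ g′ ⟫
  ⟪⟫-cong p g≈g′ = ∑-cong {xs = p} (All.tabulate λ {(a , μ)} _ → *-congˡ (g≈g′ μ))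

  ⟪⟫-zero : ∀ p → ⟪ p ∣ (λ _ → 0#) ⟫ ≈ 0#
  ⟪⟫-zero p = ∑-zero {xs = p} (All.tabulate λ {(a , μ)} _ → zeroʳ a)

  ⟪⟫-*ʳ : ∀ p a g → ⟪ p ∣ (λ μ → g μ * a) ⟫ ≈ ⟪ p ∣ g ⟫ * a
  ⟪⟫-*ʳ p a g = trans (∑-cong {xs = p} (All.tabulate λ {(b , μ)} _ → sym (*-assoc b (g μ) a)))
                      (∑-*ʳ p a λ (b , μ) → b * g μ)

  ∑-*-coefficients : ∀ a p g → ∑ p (λ (b , μ) → a * b * g μ) ≈ a * ⟪ p ∣ g ⟫
  ∑-*-coefficients a p g = trans (∑-cong {xs = p} (All.tabulate λ {(b , μ)} _ → *-assoc a b (g μ)))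
                                 (∑-*ˡ p a λ (b , μ) → b * g μ)

  ⟪⟫-++ : ∀ p q g → ⟪ p ++ q ∣ g ⟫ ≈ ⟪ p ∣ g ⟫ + ⟪ q ∣ g ⟫
  ⟪⟫-++ p q g = ∑-++ p q _

  ⟪⟫-scale : ∀ a p g → ⟪ scale a p ∣ g ⟫ ≈ a * ⟪ p ∣ g ⟫
  ⟪⟫-scale a p g = trans (reflexive (∑-map _ p _)) (∑-*-coefficients a p g)

  ⟪⟫-·ₘ : ∀ p ν g → ⟪ p ·ₘ ν ∣ g ⟫ ≡.≡ ⟪ p ∣ (λ μ → g (μ ⊕ ν)) ⟫
  ⟪⟫-·ₘ p ν g = ∑-map _ p _

  ⟪⟫-*P : ∀ r q g → ⟪ r *P q ∣ g ⟫ ≈ ⟪ r ∣ (λ μ → ⟪ q ∣ (λ ν → g (μ ⊕ ν)) ⟫) ⟫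
  ⟪⟫-*P []            q g = refl
  ⟪⟫-*P ((a , μ) ∷ r) q g = trans (⟪⟫-++ (map _ q) (r *P q) g) (+-cong
    (trans (reflexive (∑-map _ q _)) (∑-*-coefficients a q λ ν → g (μ ⊕ ν)))
    (⟪⟫-*P r q g))

  ⟪⟫-var : ∀ k g → ⟪ var k ∣ g ⟫ ≈ g (varMono k)
  ⟪⟫-var k g = trans (+-identityʳ _) (*-identityˡ _)

  δ : Mono → Mono → Carrier
  δ μ ν with ≡-dec ℕ._≟_ (normM μ) (normM ν)
  ... | yes _ = 1#
  ... | no  _ = 0#

  δ-≈ₘ : ∀ {μ ν} → μ ≈ₘ ν → δ μ ν ≈ 1#
  δ-≈ₘ {μ} {ν} (mk≈ₘ eq) with ≡-dec ℕ._≟_ (normM μ) (normM ν)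
  ... | yes _  = refl
  ... | no neq = ⊥-elim (neq eq)

  δ-≉ₘ : ∀ {μ ν} → ¬ μ ≈ₘ ν → δ μ ν ≈ 0#
  δ-≉ₘ {μ} {ν} μ≉ν with ≡-dec ℕ._≟_ (normM μ) (normM ν)
  ... | yes eq = ⊥-elim (μ≉ν (mk≈ₘ eq))
  ... | no _   = refl

  δ-cong : ∀ {μ μ′ ν ν′} → μ ≈ₘ μ′ → ν ≈ₘ ν′ → δ μ ν ≈ δ μ′ ν′
  δ-cong {μ} {μ′} {ν} {ν′} μ≈μ′ ν≈ν′ with μ ≈ₘ? ν
  ... | yes μ≈ν = trans (δ-≈ₘ μ≈ν) (sym (δ-≈ₘ (≈ₘ-trans (≈ₘ-sym μ≈μ′) (≈ₘ-trans μ≈ν ν≈ν′))))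
  ... | no  μ≉ν = trans (δ-≉ₘ μ≉ν) (sym (δ-≉ₘ λ μ′≈ν′ → μ≉ν (≈ₘ-trans μ≈μ′ (≈ₘ-trans μ′≈ν′ (≈ₘ-sym ν≈ν′)))))

  δ-⊕-cancelˡ : ∀ α μ ν → δ (α ⊕ μ) (α ⊕ ν) ≈ δ μ ν
  δ-⊕-cancelˡ α μ ν with μ ≈ₘ? ν
  ... | yes μ≈ν = trans (δ-≈ₘ (⊕-congˡ α μ≈ν)) (sym (δ-≈ₘ μ≈ν))
  ... | no  μ≉ν = trans (δ-≉ₘ (μ≉ν ∘ ⊕-cancelˡ α)) (sym (δ-≉ₘ μ≉ν))

  coeff-∷ : ∀ a μ r ν → coeff ((a , μ) ∷ r) ν ≈ a * δ μ ν + coeff r ν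
  coeff-∷ a μ r ν with ≡-dec ℕ._≟_ (normM μ) (normM ν)
  ... | yes _ = +-congʳ (sym (*-identityʳ a))
  ... | no  _ = trans (sym (+-identityˡ _)) (+-congʳ (sym (zeroʳ a)))

  coeff≈⟪δ⟫ : ∀ r ν → coeff r ν ≈ ⟪ r ∣ (λ μ → δ μ ν) ⟫
  coeff≈⟪δ⟫ []            ν = refl
  coeff≈⟪δ⟫ ((a , μ) ∷ r) ν = trans (coeff-∷ a μ r ν) (+-congˡ (coeff≈⟪δ⟫ r ν))

  coeff-cong : ∀ r → Congruent _≈ₘ_ _≈_ (coeff r)
  coeff-cong r {ν} {ν′} ν≈ν′ = begin
    coeff r ν              ≈⟨ coeff≈⟪δ⟫ r ν ⟩
    ⟪ r ∣ (λ μ → δ μ ν) ⟫  ≈⟨ ⟪⟫-cong r (λ μ → δ-cong (≈ₘ-refl {μ}) ν≈ν′) ⟩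
    ⟪ r ∣ (λ μ → δ μ ν′) ⟫ ≈⟨ coeff≈⟪δ⟫ r ν′ ⟨
    coeff r ν′             ∎

  coeff-++ : ∀ p q ν → coeff (p ++ q) ν ≈ coeff p ν + coeff q ν
  coeff-++ p q ν = trans (coeff≈⟪δ⟫ (p ++ q) ν) (trans (⟪⟫-++ p q _) (sym (+-cong (coeff≈⟪δ⟫ p ν) (coeff≈⟪δ⟫ q ν))))

  coeff-scale : ∀ a p ν → coeff (scale a p) ν ≈ a * coeff p ν
  coeff-scale a p ν = trans (coeff≈⟪δ⟫ (scale a p) ν) (trans (⟪⟫-scale a p _) (*-congˡ (sym (coeff≈⟪δ⟫ p ν))))

  coeff-combination : ∀ a b r s γ → coeff (scale a r +P scale b s) γ ≈ a * coeff r γ + b * coeff s γ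
  coeff-combination a b r s γ = trans (coeff-++ (scale a r) (scale b s) γ) (+-cong (coeff-scale a r γ) (coeff-scale b s γ))

  coeff-sumP-map : ∀ (f : A → Poly) xs γ → coeff (sumP (map f xs)) γ ≈ ∑ xs (λ x → coeff (f x) γ)
  coeff-sumP-map f []       γ = refl
  coeff-sumP-map f (x ∷ xs) γ = trans (coeff-++ (f x) (sumP (map f xs)) γ) (+-congˡ (coeff-sumP-map f xs γ))

  coeff-const : ∀ a γ → coeff (const a) γ ≈ a * δ [] γ
  coeff-const a γ = trans (coeff-∷ a [] [] γ) (+-identityʳ _)

  coeff-·ₘ : ∀ q ν γ → coeff (q ·ₘ ν) γ ≈ ⟪ q ∣ (λ β → δ (β ⊕ ν) γ) ⟫
  coeff-·ₘ q ν γ = trans (coeff≈⟪δ⟫ (q ·ₘ ν) γ) (reflexive (⟪⟫-·ₘ q ν _))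

  ·ₘ-cong : ∀ q {ν ν′} → ν ≈ₘ ν′ → q ·ₘ ν ≃ q ·ₘ ν′
  ·ₘ-cong q ν≈ν′ γ = trans (coeff-·ₘ q _ γ)
    (trans (⟪⟫-cong q (λ β → δ-cong (⊕-congˡ β ν≈ν′) (≈ₘ-refl {γ}))) (sym (coeff-·ₘ q _ γ)))

  ·ₘ-identityʳ : ∀ q → q ·ₘ [] ≃ q
  ·ₘ-identityʳ q γ = trans (coeff-·ₘ q [] γ)
    (trans (⟪⟫-cong q (λ β → reflexive (≡.cong (λ β′ → δ β′ γ) (⊕-identityʳ β)))) (sym (coeff≈⟪δ⟫ q γ)))

  ·ₘ-*P-var : ∀ q μ k → q ·ₘ (varMono k ⊕ μ) ≃ ((q ·ₘ μ) *P var k)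
  ·ₘ-*P-var q μ k γ = begin
    coeff (q ·ₘ (varMono k ⊕ μ)) γ                       ≈⟨ coeff-·ₘ q (varMono k ⊕ μ) γ ⟩
    ⟪ q ∣ (λ β → δ (β ⊕ (varMono k ⊕ μ)) γ) ⟫            ≈⟨ ⟪⟫-cong q (λ β → reflexive (≡.cong (λ β′ → δ β′ γ) (reassoc β))) ⟩
    ⟪ q ∣ (λ β → δ ((β ⊕ μ) ⊕ varMono k) γ) ⟫            ≡⟨ ⟪⟫-·ₘ q μ _ ⟨
    ⟪ q ·ₘ μ ∣ (λ β → δ (β ⊕ varMono k) γ) ⟫             ≈⟨ ⟪⟫-cong (q ·ₘ μ) (λ β → ⟪⟫-var k (λ ν → δ (β ⊕ ν) γ)) ⟨
    ⟪ q ·ₘ μ ∣ (λ β → ⟪ var k ∣ (λ ν → δ (β ⊕ ν) γ) ⟫) ⟫ ≈⟨ ⟪⟫-*P (q ·ₘ μ) (var k) _ ⟨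
    ⟪ (q ·ₘ μ) *P var k ∣ (λ β → δ β γ) ⟫                ≈⟨ coeff≈⟪δ⟫ ((q ·ₘ μ) *P var k) γ ⟨
    coeff ((q ·ₘ μ) *P var k) γ                          ∎
    where
    reassoc : ∀ β → β ⊕ (varMono k ⊕ μ) ≡.≡ (β ⊕ μ) ⊕ varMono k
    reassoc β = ≡.trans (≡.cong (β ⊕_) (⊕-comm (varMono k) μ)) (≡.sym (⊕-assoc β μ (varMono k)))

  support : Poly → List Mono
  support r = deduplicate _≈ₘ?_ (map proj₂ r)

  support-unique : ∀ r → Unique (support r)
  support-unique r = deduplicate-! ≈ₘ-decSetoid (map proj₂ r)

  support-covers : ∀ r → All (λ (a , μ) → Any (μ ≈ₘ_) (support r)) r
  support-covers r = All.tabulate λ t∈r →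
    Anyₚ.deduplicate⁺ _≈ₘ?_ (λ ν′≈ν μ≈ν′ → ≈ₘ-trans μ≈ν′ (≈ₘ-sym ν′≈ν)) (lose (∈-map⁺ proj₂ t∈r) ≈ₘ-refl)

  ∑-δ : ∀ {g} → Congruent _≈ₘ_ _≈_ g → ∀ {μ U} → Unique U → Any (μ ≈ₘ_) U →
        ∑ U (λ ν → δ μ ν * g ν) ≈ g μ
  ∑-δ {g} g-cong {μ} {ν ∷ U} (ν∉U ∷ _) (here μ≈ν) = begin
    δ μ ν * g ν + ∑ U (λ ν′ → δ μ ν′ * g ν′) ≈⟨ +-cong (*-congʳ (δ-≈ₘ μ≈ν)) (∑-zero (All.map δ≈0 ν∉U)) ⟩
    1# * g ν + 0#                            ≈⟨ +-identityʳ _ ⟩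
    1# * g ν                                 ≈⟨ *-identityˡ _ ⟩
    g ν                                      ≈⟨ g-cong (≈ₘ-sym μ≈ν) ⟩
    g μ                                      ∎
    where
    δ≈0 : ∀ {ν′} → ¬ ν ≈ₘ ν′ → δ μ ν′ * g ν′ ≈ 0#
    δ≈0 ν≉ν′ = trans (*-congʳ (δ-≉ₘ (ν≉ν′ ∘ ≈ₘ-trans (≈ₘ-sym μ≈ν)))) (zeroˡ _)
  ∑-δ {g} g-cong {μ} {ν ∷ U} (ν∉U ∷ U-unique) (there μ∈U) = begin
    δ μ ν * g ν + ∑ U (λ ν′ → δ μ ν′ * g ν′) ≈⟨ +-cong (trans (*-congʳ (δ-≉ₘ μ≉ν)) (zeroˡ _)) (∑-δ g-cong U-unique μ∈U) ⟩
    0# + g μ                                 ≈⟨ +-identityˡ _ ⟩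
    g μ                                      ∎
    where
    μ≉ν : ¬ μ ≈ₘ ν
    μ≉ν μ≈ν = All.lookupWith (λ ν≉ν′ μ≈ν′ → ν≉ν′ (≈ₘ-trans (≈ₘ-sym μ≈ν) μ≈ν′)) ν∉U μ∈U

  ⟪⟫-regroup-over : ∀ {g} → Congruent _≈ₘ_ _≈_ g → ∀ {U} → Unique U →
                    ∀ r → All (λ (a , μ) → Any (μ ≈ₘ_) U) r → ⟪ r ∣ g ⟫ ≈ ∑ U (λ ν → coeff r ν * g ν)
  ⟪⟫-regroup-over g-cong {U} U-unique [] [] = sym (∑-zero {xs = U} (All.tabulate λ _ → zeroˡ _))
  ⟪⟫-regroup-over {g} g-cong {U} U-unique ((a , μ) ∷ r) (μ∈U ∷ r⊆U) = sym (begin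
    ∑ U (λ ν → coeff ((a , μ) ∷ r) ν * g ν)
      ≈⟨ ∑-cong {xs = U} (All.tabulate λ {ν} _ → trans (*-congʳ (coeff-∷ a μ r ν)) (distribʳ (g ν) _ _)) ⟩
    ∑ U (λ ν → a * δ μ ν * g ν + coeff r ν * g ν)
      ≈⟨ ∑-+ U _ _ ⟩
    ∑ U (λ ν → a * δ μ ν * g ν) + ∑ U (λ ν → coeff r ν * g ν)
      ≈⟨ +-congʳ (∑-cong {xs = U} (All.tabulate λ {ν} _ → *-assoc a (δ μ ν) (g ν))) ⟩
    ∑ U (λ ν → a * (δ μ ν * g ν)) + ∑ U (λ ν → coeff r ν * g ν)
      ≈⟨ +-cong (trans (∑-*ˡ U a _) (*-congˡ (∑-δ g-cong U-unique μ∈U))) (sym (⟪⟫-regroup-over g-cong U-unique r r⊆U)) ⟩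
    a * g μ + ⟪ r ∣ g ⟫
      ∎)

  ⟪⟫-regroup : ∀ r {g} → Congruent _≈ₘ_ _≈_ g → ⟪ r ∣ g ⟫ ≈ ∑ (support r) (λ ν → coeff r ν * g ν)
  ⟪⟫-regroup r g-cong = ⟪⟫-regroup-over g-cong (support-unique r) r (support-covers r)

  ⟪⟫-cong-nonzero : ∀ r {g g′} → Congruent _≈ₘ_ _≈_ g → Congruent _≈ₘ_ _≈_ g′ →
                    (∀ μ → coeff r μ ≉ 0# → g μ ≈ g′ μ) → ⟪ r ∣ g ⟫ ≈ ⟪ r ∣ g′ ⟫
  ⟪⟫-cong-nonzero r {g} {g′} g-cong g′-cong g≈g′ = begin
    ⟪ r ∣ g ⟫                              ≈⟨ ⟪⟫-regroup r g-cong ⟩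
    ∑ (support r) (λ ν → coeff r ν * g ν)  ≈⟨ ∑-cong {xs = support r} (All.tabulate λ {ν} _ → term ν) ⟩
    ∑ (support r) (λ ν → coeff r ν * g′ ν) ≈⟨ ⟪⟫-regroup r g′-cong ⟨
    ⟪ r ∣ g′ ⟫                             ∎
    where
    term : ∀ ν → coeff r ν * g ν ≈ coeff r ν * g′ ν
    term ν with coeff r ν ≈0?
    ... | yes c≈0 = trans (*-congʳ c≈0) (trans (zeroˡ _) (sym (trans (*-congʳ c≈0) (zeroˡ _))))
    ... | no  c≉0 = *-congˡ (g≈g′ ν c≉0)

  ⟪⟫-concentrated : ∀ r {g} α → Congruent _≈ₘ_ _≈_ g →
                    (∀ μ → coeff r μ ≉ 0# → ¬ μ ≈ₘ α → g μ ≈ 0#) → ⟪ r ∣ g ⟫ ≈ coeff r α * g α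
  ⟪⟫-concentrated r {g} α g-cong g-vanishes = begin
    ⟪ r ∣ g ⟫                   ≈⟨ ⟪⟫-cong-nonzero r g-cong (λ μ≈μ′ → *-congʳ (δ-cong μ≈μ′ (≈ₘ-refl {α}))) g≈δ ⟩
    ⟪ r ∣ (λ μ → δ μ α * g α) ⟫ ≈⟨ ⟪⟫-*ʳ r (g α) (λ μ → δ μ α) ⟩
    ⟪ r ∣ (λ μ → δ μ α) ⟫ * g α ≈⟨ *-congʳ (coeff≈⟪δ⟫ r α) ⟨
    coeff r α * g α             ∎
    where
    g≈δ : ∀ μ → coeff r μ ≉ 0# → g μ ≈ δ μ α * g α
    g≈δ μ c≉0 with μ ≈ₘ? α
    ... | yes μ≈α = trans (g-cong μ≈α) (sym (trans (*-congʳ (δ-≈ₘ μ≈α)) (*-identityˡ _)))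
    ... | no  μ≉α = trans (g-vanishes μ c≉0 μ≉α) (sym (trans (*-congʳ (δ-≉ₘ μ≉α)) (zeroˡ _)))

  *P≃∑-·ₘ : ∀ r q → (r *P q) ≃ sumP (map (λ ν → scale (coeff r ν) (q ·ₘ ν)) (support r))
  *P≃∑-·ₘ r q γ = begin
    coeff (r *P q) γ                                                    ≈⟨ coeff≈⟪δ⟫ (r *P q) γ ⟩
    ⟪ r *P q ∣ (λ μ → δ μ γ) ⟫                                          ≈⟨ ⟪⟫-*P r q _ ⟩
    ⟪ r ∣ h ⟫                                                           ≈⟨ ⟪⟫-regroup r h-cong ⟩
    ∑ (support r) (λ ν → coeff r ν * h ν)                               ≈⟨ ∑-cong {xs = support r} (All.tabulate λ {ν} _ → term ν) ⟩
    ∑ (support r) (λ ν → coeff (scale (coeff r ν) (q ·ₘ ν)) γ)          ≈⟨ coeff-sumP-map _ (support r) γ ⟨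
    coeff (sumP (map (λ ν → scale (coeff r ν) (q ·ₘ ν)) (support r))) γ ∎
    where
    h : Mono → Carrier
    h μ = ⟪ q ∣ (λ β → δ (μ ⊕ β) γ) ⟫
    h-cong : Congruent _≈ₘ_ _≈_ h
    h-cong μ≈μ′ = ⟪⟫-cong q (λ β → δ-cong (⊕-congʳ β μ≈μ′) (≈ₘ-refl {γ}))
    term : ∀ ν → coeff r ν * h ν ≈ coeff (scale (coeff r ν) (q ·ₘ ν)) γ
    term ν = sym (trans (coeff-scale (coeff r ν) (q ·ₘ ν) γ) (*-congˡ (trans (coeff-·ₘ q ν γ)
               (⟪⟫-cong q (λ β → reflexive (≡.cong (λ β′ → δ β′ γ) (⊕-comm β ν)))))))

  coeff-≉0⇒∈support : ∀ r {μ} → coeff r μ ≉ 0# → Any (μ ≈ₘ_) (support r)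
  coeff-≉0⇒∈support r {μ} c≉0 with any? (μ ≈ₘ?_) (support r)
  ... | yes μ∈ = μ∈
  ... | no  μ∉ = ⊥-elim (c≉0 (begin
    coeff r μ                               ≈⟨ coeff≈⟪δ⟫ r μ ⟩
    ⟪ r ∣ (λ ν → δ ν μ) ⟫                   ≈⟨ ⟪⟫-regroup r (λ ν≈ν′ → δ-cong ν≈ν′ (≈ₘ-refl {μ})) ⟩
    ∑ (support r) (λ ν → coeff r ν * δ ν μ) ≈⟨ ∑-zero (All.tabulate λ ν∈ → trans (*-congˡ (δ-≉ₘ λ ν≈μ → μ∉ (lose ν∈ (≈ₘ-sym ν≈μ)))) (zeroʳ _)) ⟩
    0#                                      ∎))

  record IsLeading (r : Poly) (m : Mono) : Set ℓ where
    field
      nonzero : coeff r m ≉ 0#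
      maximal : ∀ μ → coeff r μ ≉ 0# → μ ≤ₘ m

  leading : ∀ r {α} → coeff r α ≉ 0# → Σ Mono (IsLeading r)
  leading r {α} α≉0 = m , record { nonzero = proj₂ (∈-filter⁻ nonzero? {xs = support r} m∈N) ; maximal = maximal }
    where
    open import Data.List.Extrema ≤ₘ-totalOrder using (max; xs≤max; argmax-sel)
    nonzero? : U.Decidable (λ μ → coeff r μ ≉ 0#)
    nonzero? μ = ¬? (coeff r μ ≈0?)
    N : List Mono
    N = filter nonzero? (support r)
    representative : ∀ {μ} → coeff r μ ≉ 0# → Σ Mono λ μ′ → μ′ ∈ N × μ ≈ₘ μ′
    representative {μ} c≉0 with find (coeff-≉0⇒∈support r c≉0)
    ... | μ′ , μ′∈ , μ≈μ′ = μ′ , ∈-filter⁺ nonzero? μ′∈ (c≉0 ∘ trans (coeff-cong r μ≈μ′)) , μ≈μ′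
    m : Mono
    m = max (proj₁ (representative α≉0)) N
    m∈N : m ∈ N
    m∈N with argmax-sel id (proj₁ (representative α≉0)) N
    ... | inj₁ m≡α′ = ≡.subst (_∈ N) (≡.sym m≡α′) (proj₁ (proj₂ (representative α≉0)))
    ... | inj₂ m∈N′ = m∈N′
    maximal : ∀ μ → coeff r μ ≉ 0# → μ ≤ₘ m
    maximal μ c≉0 with representative c≉0
    ... | μ′ , μ′∈N , μ≈μ′ = ≤ₘ-trans (inj₂ μ≈μ′) (All.lookup (xs≤max _ N) μ′∈N)

  -- Only the terms μ ⊕ ν with μ ≈ α contribute, and then ν ≈ β by cancellation.
  coeff-*P-leading : ∀ r q {α β} → IsLeading r α → IsLeading q β →
                     coeff (r *P q) (α ⊕ β) ≈ coeff r α * coeff q β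
  coeff-*P-leading r q {α} {β} α-lead β-lead = begin
    coeff (r *P q) (α ⊕ β)           ≈⟨ coeff≈⟪δ⟫ (r *P q) (α ⊕ β) ⟩
    ⟪ r *P q ∣ (λ μ → δ μ (α ⊕ β)) ⟫ ≈⟨ ⟪⟫-*P r q _ ⟩
    ⟪ r ∣ h ⟫                        ≈⟨ ⟪⟫-concentrated r α h-cong h-vanishes ⟩
    coeff r α * h α                  ≈⟨ *-congˡ h[α]≈coeff ⟩
    coeff r α * coeff q β            ∎
    where
    h : Mono → Carrier
    h μ = ⟪ q ∣ (λ ν → δ (μ ⊕ ν) (α ⊕ β)) ⟫
    h-cong : Congruent _≈ₘ_ _≈_ h
    h-cong μ≈μ′ = ⟪⟫-cong q (λ ν → δ-cong (⊕-congʳ ν μ≈μ′) (≈ₘ-refl {α ⊕ β}))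
    h-vanishes : ∀ μ → coeff r μ ≉ 0# → ¬ μ ≈ₘ α → h μ ≈ 0#
    h-vanishes μ μ≉0 μ≉α = trans
      (⟪⟫-cong-nonzero q (λ ν≈ν′ → δ-cong (⊕-congˡ μ ν≈ν′) (≈ₘ-refl {α ⊕ β})) (λ _ → refl)
        λ ν ν≉0 → δ-≉ₘ (μ≉α ∘ ≤ₘ-⊕-tight (IsLeading.maximal α-lead μ μ≉0) (IsLeading.maximal β-lead ν ν≉0)))
      (⟪⟫-zero q)
    h[α]≈coeff : h α ≈ coeff q β
    h[α]≈coeff = trans (⟪⟫-cong q (λ ν → δ-⊕-cancelˡ α ν β)) (sym (coeff≈⟪δ⟫ q β))

  DegLe-const : ∀ a {d} → DegLe (const a) d
  DegLe-const a γ d<γ = trans (coeff-const a γ) (trans (*-congˡ (δ-≉ₘ {[]} {γ} []≉γ)) (zeroʳ a))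
    where
    []≉γ : ¬ [] ≈ₘ γ
    []≉γ []≈γ = ℕₚ.<⇒≱ d<γ (ℕₚ.≤-trans (ℕₚ.≤-reflexive (≡.sym (≈ₘ⇒degM≡ []≈γ))) ℕ.z≤n)

  DegLe-·ₘ : ∀ q ν {d} → (∀ β → coeff q β ≉ 0# → degM ν ℕ.+ degM β ℕ.≤ d) → DegLe (q ·ₘ ν) d
  DegLe-·ₘ q ν {d} bound γ d<γ = begin
    coeff (q ·ₘ ν) γ            ≈⟨ coeff-·ₘ q ν γ ⟩
    ⟪ q ∣ (λ β → δ (β ⊕ ν) γ) ⟫ ≈⟨ ⟪⟫-cong-nonzero q (λ β≈β′ → δ-cong (⊕-congʳ ν β≈β′) (≈ₘ-refl {γ})) (λ _ → refl) vanishes ⟩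
    ⟪ q ∣ (λ _ → 0#) ⟫          ≈⟨ ⟪⟫-zero q ⟩
    0#                          ∎
    where
    vanishes : ∀ β → coeff q β ≉ 0# → δ (β ⊕ ν) γ ≈ 0#
    vanishes β β≉0 = δ-≉ₘ {β ⊕ ν} {γ} λ βν≈γ → ℕₚ.<⇒≱ d<γ (≡.subst (ℕ._≤ d)
      (≡.trans (≡.sym (degM-⊕ ν β)) (≡.trans (≡.cong degM (⊕-comm ν β)) (≈ₘ⇒degM≡ βν≈γ))) (bound β β≉0))

  DegLe-*P⇒degM+degM≤ : ∀ r q {d μ ν} → DegLe (r *P q) d → coeff r μ ≉ 0# → coeff q ν ≉ 0# →
                        degM μ ℕ.+ degM ν ℕ.≤ d
  DegLe-*P⇒degM+degM≤ r q {d} {μ} {ν} rq≤d μ≉0 ν≉0 with leading r μ≉0 | leading q ν≉0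
  ... | α , α-lead | β , β-lead = ℕₚ.≤-trans
    (ℕₚ.+-mono-≤ (≤ₘ⇒degM≤ (IsLeading.maximal α-lead μ μ≉0)) (≤ₘ⇒degM≤ (IsLeading.maximal β-lead ν ν≉0)))
    (≡.subst (ℕ._≤ d) (degM-⊕ α β) degM[α⊕β]≤d)
    where
    degM[α⊕β]≤d : degM (α ⊕ β) ℕ.≤ d
    degM[α⊕β]≤d with degM (α ⊕ β) ℕ.≤? d
    ... | yes ≤d = ≤d
    ... | no  ≰d = ⊥-elim (*-nonzero (IsLeading.nonzero α-lead) (IsLeading.nonzero β-lead)
                     (trans (sym (coeff-*P-leading r q α-lead β-lead)) (rq≤d (α ⊕ β) (ℕₚ.≰⇒> ≰d))))

module Derivations {c ℓ ι} (F : RealField c ℓ) {I : Set ι} (p : I → PolyOver.Poly F) (d : ℕ) where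
  open RealField F
  open PolyOver F
  open OrderedField F
  open Monomials F
  open Polynomials F
  open import Level using (Level)
  open import Data.Bool using (Bool)
  import Data.Nat as ℕ
  import Data.Nat.Properties as ℕₚ
  open import Data.List using ([]; _∷_; map; length)
  open import Data.List.Membership.Propositional using (_∈_)
  open import Data.List.Relation.Unary.Any using (here; there)
  open import Function using (_∘_)
  open import Relation.Nullary using (yes; no)
  import Relation.Binary.PropositionalEquality as ≡
  open import Relation.Binary.Reasoning.Setoid setoid
  open import Algebra.Properties.AbelianGroup +-abelianGroup using (⁻¹-∙-comm)
  open import Algebra.Properties.Ring ring using (-1*x≈-x; -‿involutive)

  private
    variable
      a : Level
      A : Set a
      rad : Bool
      q r s : Poly

  PC⁺⇒DegLe : PC⁺ p d rad q → DegLe q d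
  PC⁺⇒DegLe (axiom _ _ q≤d)           = q≤d
  PC⁺⇒DegLe (zero= q≃0) γ _           = q≃0 γ
  PC⁺⇒DegLe (add _ _ _ _ _ q≤d)       = q≤d
  PC⁺⇒DegLe (mult _ _ _ q≤d)          = q≤d
  PC⁺⇒DegLe (radical _ _ _ q≤d)       = q≤d
  PC⁺⇒DegLe (sos _ _ _ _ _ q≤d)       = q≤d

  PC⁺-combination : ∀ a b → PC⁺ p d rad r → PC⁺ p d rad s → q ≃ (scale a r +P scale b s) → PC⁺ p d rad q
  PC⁺-combination {r = r} {s = s} {q = q} a b Dr Ds q≃ar+bs = add Dr Ds a b q≃ar+bs λ γ d<γ → begin
    coeff q γ                        ≈⟨ q≃ar+bs γ ⟩
    coeff (scale a r +P scale b s) γ ≈⟨ coeff-combination a b r s γ ⟩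
    a * coeff r γ + b * coeff s γ    ≈⟨ +-cong (*-congˡ (PC⁺⇒DegLe Dr γ d<γ)) (*-congˡ (PC⁺⇒DegLe Ds γ d<γ)) ⟩
    a * 0# + b * 0#                  ≈⟨ +-cong (zeroʳ a) (zeroʳ b) ⟩
    0# + 0#                          ≈⟨ +-identityʳ 0# ⟩
    0#                               ∎

  PC⁺-resp : q ≃ r → PC⁺ p d rad r → PC⁺ p d rad q
  PC⁺-resp {r = r} q≃r Dr = PC⁺-combination 1# 0# Dr Dr λ γ → trans (q≃r γ) (sym (begin
    coeff (scale 1# r +P scale 0# r) γ ≈⟨ coeff-combination 1# 0# r r γ ⟩
    1# * coeff r γ + 0# * coeff r γ    ≈⟨ +-cong (*-identityˡ _) (zeroˡ _) ⟩
    coeff r γ + 0#                     ≈⟨ +-identityʳ _ ⟩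
    coeff r γ                          ∎))

  PC⁺-scale : ∀ a → PC⁺ p d rad r → PC⁺ p d rad (scale a r)
  PC⁺-scale {r = r} a Dr = PC⁺-combination a 0# Dr Dr λ γ → sym (begin
    coeff (scale a r +P scale 0# r) γ ≈⟨ coeff-combination a 0# r r γ ⟩
    a * coeff r γ + 0# * coeff r γ    ≈⟨ +-congˡ (zeroˡ _) ⟩
    a * coeff r γ + 0#                ≈⟨ +-identityʳ _ ⟩
    a * coeff r γ                     ≈⟨ coeff-scale a r γ ⟨
    coeff (scale a r) γ               ∎)

  PC⁺-+ : PC⁺ p d rad r → PC⁺ p d rad s → PC⁺ p d rad (r +P s)
  PC⁺-+ {r = r} {s = s} Dr Ds = PC⁺-combination 1# 1# Dr Ds λ γ → begin
    coeff (r +P s) γ                   ≈⟨ coeff-++ r s γ ⟩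
    coeff r γ + coeff s γ              ≈⟨ +-cong (*-identityˡ _) (*-identityˡ _) ⟨
    1# * coeff r γ + 1# * coeff s γ    ≈⟨ coeff-combination 1# 1# r s γ ⟨
    coeff (scale 1# r +P scale 1# s) γ ∎

  PC⁺-zero : PC⁺ p d rad zeroP
  PC⁺-zero = zero= λ _ → refl

  PC⁺-sumP-map : ∀ (f : A → Poly) xs → (∀ {x} → x ∈ xs → PC⁺ p d rad (f x)) → PC⁺ p d rad (sumP (map f xs))
  PC⁺-sumP-map f []       _  = PC⁺-zero
  PC⁺-sumP-map f (x ∷ xs) Df = PC⁺-+ (Df (here ≡.refl)) (PC⁺-sumP-map f xs (Df ∘ there))

  PC⁺-·ₘ-∏ : ∀ i ks → (∀ β → coeff (p i) β ≉ 0# → length ks ℕ.+ degM β ℕ.≤ d) → PC⁺ p d rad (p i ·ₘ ∏ ks)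
  PC⁺-·ₘ-∏ i []       bound = axiom i (·ₘ-identityʳ (p i)) (DegLe-·ₘ (p i) [] bound)
  PC⁺-·ₘ-∏ i (k ∷ ks) bound =
    mult (PC⁺-·ₘ-∏ i ks λ β β≉0 → ℕₚ.≤-trans (ℕₚ.+-monoˡ-≤ (degM β) (ℕₚ.n≤1+n (length ks))) (bound β β≉0))
         k (·ₘ-*P-var (p i) (∏ ks) k)
         (DegLe-·ₘ (p i) (∏ (k ∷ ks)) λ β β≉0 → ≡.subst (λ n → n ℕ.+ degM β ℕ.≤ d) (≡.sym (degM-∏ (k ∷ ks))) (bound β β≉0))

  PC⁺-·ₘ : ∀ i ν → (∀ β → coeff (p i) β ≉ 0# → degM ν ℕ.+ degM β ℕ.≤ d) → PC⁺ p d rad (p i ·ₘ ν)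
  PC⁺-·ₘ i ν bound = PC⁺-resp (·ₘ-cong (p i) (≈ₘ-sym (∏-indices ν))) (PC⁺-·ₘ-∏ i (indices ν)
    λ β β≉0 → ≡.subst (λ n → n ℕ.+ degM β ℕ.≤ d) (≡.sym (length-indices ν)) (bound β β≉0))

  PC⁺-*P : ∀ i r → DegLe (r *P p i) d → PC⁺ p d rad (r *P p i)
  PC⁺-*P i r rp≤d = PC⁺-resp (*P≃∑-·ₘ r (p i)) (PC⁺-sumP-map _ (support r) λ {ν} _ → term ν)
    where
    term : ∀ ν → PC⁺ p d rad (scale (coeff r ν) (p i ·ₘ ν))
    term ν with coeff r ν ≈0?
    ... | yes c≈0 = PC⁺-resp (λ γ → trans (coeff-scale (coeff r ν) (p i ·ₘ ν) γ) (trans (*-congʳ c≈0) (zeroˡ _))) PC⁺-zero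
    ... | no  c≉0 = PC⁺-scale (coeff r ν) (PC⁺-·ₘ i ν λ β β≉0 → DegLe-*P⇒degM+degM≤ r (p i) rp≤d c≉0 β≉0)

  PC⁺-sos-refutation : ∀ {L} ss → PC⁺ p d rad L → (L +P sumSquares ss) ≃ const (- 1#) → PC⁺ p d rad oneP
  PC⁺-sos-refutation {L = L} ss DL L+S≃-1 = sos oneP ss (PC⁺-scale (- 1#) DL) -L≃1²+S oneP≃1² (DegLe-const 1#)
    where
    S = sumSquares ss
    1*1*x≈x : ∀ x → 1# * 1# * x ≈ x
    1*1*x≈x x = trans (*-congʳ (*-identityˡ 1#)) (*-identityˡ x)
    oneP≃1² : oneP ≃ (oneP *P oneP)
    oneP≃1² γ = trans (coeff-const 1# γ) (trans (*-identityˡ _) (sym (trans (coeff-const (1# * 1#) γ) (1*1*x≈x _))))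
    -L≃1²+S : scale (- 1#) L ≃ ((oneP *P oneP) +P S)
    -L≃1²+S γ = begin
      coeff (scale (- 1#) L) γ              ≈⟨ coeff-scale (- 1#) L γ ⟩
      - 1# * coeff L γ                      ≈⟨ -1*x≈-x _ ⟩
      - coeff L γ                           ≈⟨ x-y+y≈x (- coeff L γ) (coeff S γ) ⟨
      - coeff L γ - coeff S γ + coeff S γ   ≈⟨ +-congʳ (⁻¹-∙-comm (coeff L γ) (coeff S γ)) ⟩
      - (coeff L γ + coeff S γ) + coeff S γ ≈⟨ +-congʳ (-‿cong (trans (sym (coeff-++ L S γ)) (L+S≃-1 γ))) ⟩
      - coeff (const (- 1#)) γ + coeff S γ  ≈⟨ +-congʳ (-‿cong (trans (coeff-const (- 1#) γ) (-1*x≈-x _))) ⟩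
      - (- δ [] γ) + coeff S γ              ≈⟨ +-congʳ (-‿involutive _) ⟩
      δ [] γ + coeff S γ                    ≈⟨ +-congʳ (trans (coeff-const (1# * 1#) γ) (1*1*x≈x _)) ⟨
      coeff (oneP *P oneP) γ + coeff S γ    ≈⟨ coeff-++ (oneP *P oneP) S γ ⟨
      coeff ((oneP *P oneP) +P S) γ         ∎

proposition2p14 : ∀ {c ℓ ι : Level} (F : RealField c ℓ) {I : Set ι}
    (p : I → PolyOver.Poly F) (d : ℕ) →
    PolyOver.SoSRefutation F p d → PolyOver.PC⁺Refutation F p d false
proposition2p14 F p d refutation =
  PC⁺-sos-refutation ss (PC⁺-sumP-map _ rs λ {(i , r)} i,r∈rs → PC⁺-*P i r (degR i,r∈rs)) identity
  where
  open Derivations F p d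
  open PolyOver.SoSRefutation refutation
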